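{- For every $e\geq 0$, the polynomial $$\psi_e=(-1)^e\sum_{n=0}^{3\cdot 2^e}t(3\cdot 2^e+n)z^n$$ satisfies $$\psi_e=z(1+z^{2^e})(1+z+z^2)^e\prod_{n=0}^{e-2}\left(1-z^{2^n}+z^{2^{n+1}}\right)^{e-1-n}=z(1+z^{2^e})\prod_{n=0}^{e-1}\left(1+z^{2^n}+z^{2^{n+1}}\right).$$
   Context: The twisted Stern sequence $t$ is defined by $t(0)=0$, $t(1)=1$, $t(2n)=-t(n)$, $t(2n+1)=-t(n)-t(n+1)$ for $n\geq 1$. Empty products equal $1$. -}

module Defs where

open import Data.Nat using (ℕ; zero; suc; _∸_; ⌊_/2⌋)
open import Data.Bool using (Bool; true; false; if_then_else_)
open import Data.Integer using (ℤ; 0ℤ; 1ℤ; -1ℤ; -_; _-_) renaming (_+_ to _+ℤ_; _*_ to _*ℤ_; _^_ to _^ℤ_)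
open import Data.List using (List; []; _∷_; map; applyUpTo; replicate)
open import Relation.Binary.PropositionalEquality using (_≡_)

-- The twisted Stern sequence
-- t(0)=0, t(1)=1, t(2n)=-t(n), t(2n+1)=-t(n)-t(n+1) for n ≥ 1.
-- Implemented with a fuel argument; fuel (suc m) suffices for argument m
-- since every recursive call has a strictly smaller argument.

isEven : ℕ → Bool
isEven zero = true
isEven (suc zero) = false
isEven (suc (suc n)) = isEven n

tFuel : ℕ → ℕ → ℤ
tFuel zero _ = 0ℤ
tFuel (suc f) zero = 0ℤ
tFuel (suc f) (suc zero) = 1ℤ
tFuel (suc f) (suc (suc m)) =
  if isEven m
  then - tFuel f (suc ⌊ m /2⌋)                                 -- m+2 = 2(k+1), k = m/2
  else - tFuel f (suc ⌊ m /2⌋) - tFuel f (suc (suc ⌊ m /2⌋))    -- m+2 = 2(k+1)+1, k = (m-1)/2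

t : ℕ → ℤ
t n = tFuel (suc n) n

-- Polynomials in z with integer coefficients, as coefficient lists
-- (lowest degree first).  Equality is coefficientwise.

Poly : Set
Poly = List ℤ

coeff : Poly → ℕ → ℤ
coeff [] _ = 0ℤ
coeff (a ∷ p) zero = a
coeff (a ∷ p) (suc n) = coeff p n

_≈P_ : Poly → Poly → Set
p ≈P q = ∀ n → coeff p n ≡ coeff q n

infix 4 _≈P_
infixl 6 _+P_ _-P_
infixl 7 _*P_

_+P_ : Poly → Poly → Poly
[] +P q = q
(a ∷ p) +P [] = a ∷ p
(a ∷ p) +P (b ∷ q) = (a +ℤ b) ∷ (p +P q)

scale : ℤ → Poly → Poly
scale c = map (c *ℤ_)

negP : Poly → Poly
negP = scale -1ℤ

_-P_ : Poly → Poly → Poly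
p -P q = p +P negP q

_*P_ : Poly → Poly → Poly
[] *P q = []
(a ∷ p) *P q = scale a q +P (0ℤ ∷ (p *P q))

constP : ℤ → Poly
constP c = c ∷ []

oneP : Poly
oneP = constP 1ℤ

zPow : ℕ → Poly
zPow k = replicate k 0ℤ Data.List.++ (1ℤ ∷ [])

z : Poly
z = zPow 1

_^P_ : Poly → ℕ → Poly
p ^P zero = oneP
p ^P suc k = p *P (p ^P k)

prodBelow : ℕ → (ℕ → Poly) → Poly
prodBelow zero f = oneP
prodBelow (suc k) f = prodBelow k f *P f k

open import Data.Nat using (_*_; _^_; _+_)

psi : ℕ → Poly
psi e = scale (-1ℤ ^ℤ e) (applyUpTo (λ n → t (3 * 2 ^ e + n)) (suc (3 * 2 ^ e)))

-- Writing ψ_e = (-1)^e Σ_{n ≤ M} t(M + n) zⁿ with M = 3·2^e, the recursion of t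
-- (t(2m) = -t(m), t(2m+1) = -t(m) - t(m+1)) together with t(3·2^e) = 0 says
-- exactly that z ψ_{e+1}(z) = (1 + z + z²) ψ_e(z²).  Since ψ_0 = z(1 + z),
-- iterating gives ψ_e = z (1 + z^{2^e}) ∏_{n<e} Φ_n with Φ_n = 1 + z^{2^n} + z^{2^{n+1}}.
-- The first form follows from Φ_{n+1} = Φ_n Ψ_n, where Ψ_n = 1 - z^{2^n} + z^{2^{n+1}}
-- (the case n = 0 is (1 + z + z²)(1 - z + z²) = 1 + z² + z⁴, the rest by z ↦ z²),
-- so that Φ_n = Φ_0 ∏_{m<n} Ψ_m.
module Submission where

open import Defs
open import Data.Nat using (ℕ; suc; _∸_; _^_)
open import Data.Product using (_×_)

open import Algebra.Bundles using (CommutativeSemigroup)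
import Algebra.Properties.CommutativeSemigroup as CommutativeSemigroupProperties
open import Data.Bool using (true; false; if_then_else_)
open import Data.Integer using (ℤ; 0ℤ; 1ℤ; -1ℤ; -_; _-_)
  renaming (_+_ to _+ℤ_; _*_ to _*ℤ_; _^_ to _^ℤ_)
import Data.Integer.Properties as ℤ
import Data.Integer.Tactic.RingSolver as ℤ-Solver
import Data.Nat.Tactic.RingSolver as ℕ-Solver
open import Data.List using (_∷_; []; applyUpTo)
open import Data.Nat using (zero; _+_; _*_; _≤_; _<_; z≤n; s≤s; ⌊_/2⌋)
open import Data.Nat.Properties
  using (≤-refl; ≤-trans; n≤1+n; m≤n⇒m≤1+n; m≤m+n; ≤-pred; ⌊n/2⌋<n; +-suc; *-suc;
         +-∸-assoc; n∸n≡0; +-identityʳ; ≤-<-connex; <-≤-connex; m≤n⇒m<n∨m≡n)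
open import Data.Product using (_,_)
open import Data.Sum using (inj₁; inj₂)
open import Relation.Binary.Bundles using (Setoid)
open import Relation.Binary.PropositionalEquality
  using (_≡_; refl; sym; trans; cong; cong₂; subst; module ≡-Reasoning)
import Relation.Binary.Reasoning.Setoid

-- Polynomial arithmetic up to coefficientwise equality

-- A record around _≈P_, so that both polynomials can be inferred from a proof.
record _≋_ (p q : Poly) : Set where
  constructor ≈P⇒≋
  field ≋⇒≈P : p ≈P q
open _≋_

infix 4 _≋_

≋-refl : ∀ {p} → p ≋ p
≋-refl = ≈P⇒≋ λ _ → refl

≋-sym : ∀ {p q} → p ≋ q → q ≋ p
≋-sym (≈P⇒≋ h) = ≈P⇒≋ λ n → sym (h n)

≋-trans : ∀ {p q r} → p ≋ q → q ≋ r → p ≋ r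
≋-trans (≈P⇒≋ h) (≈P⇒≋ g) = ≈P⇒≋ λ n → trans (h n) (g n)

≡⇒≋ : ∀ {p q} → p ≡ q → p ≋ q
≡⇒≋ refl = ≋-refl

Poly-setoid : Setoid _ _
Poly-setoid = record
  { Carrier = Poly ; _≈_ = _≋_
  ; isEquivalence = record { refl = ≋-refl ; sym = ≋-sym ; trans = ≋-trans } }

module ≋-Reasoning = Relation.Binary.Reasoning.Setoid Poly-setoid

∷-cong : ∀ {a b p q} → a ≡ b → p ≋ q → a ∷ p ≋ b ∷ q
∷-cong a≡b (≈P⇒≋ h) = ≈P⇒≋ λ { zero → a≡b ; (suc n) → h n }

0∷[]≋[] : 0ℤ ∷ [] ≋ []
0∷[]≋[] = ≈P⇒≋ λ { zero → refl ; (suc n) → refl }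

coeff-+P : ∀ p q n → coeff (p +P q) n ≡ coeff p n +ℤ coeff q n
coeff-+P []      q       n       = sym (ℤ.+-identityˡ _)
coeff-+P (a ∷ p) []      n       = sym (ℤ.+-identityʳ _)
coeff-+P (a ∷ p) (b ∷ q) zero    = refl
coeff-+P (a ∷ p) (b ∷ q) (suc n) = coeff-+P p q n

coeff-scale : ∀ c p n → coeff (scale c p) n ≡ c *ℤ coeff p n
coeff-scale c []      n       = sym (ℤ.*-zeroʳ c)
coeff-scale c (a ∷ p) zero    = refl
coeff-scale c (a ∷ p) (suc n) = coeff-scale c p n

+P-cong : ∀ {p p′ q q′} → p ≋ p′ → q ≋ q′ → p +P q ≋ p′ +P q′
+P-cong {p} {p′} {q} {q′} (≈P⇒≋ h) (≈P⇒≋ g) = ≈P⇒≋ λ n → begin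
  coeff (p +P q) n          ≡⟨ coeff-+P p q n ⟩
  coeff p n +ℤ coeff q n    ≡⟨ cong₂ _+ℤ_ (h n) (g n) ⟩
  coeff p′ n +ℤ coeff q′ n  ≡⟨ coeff-+P p′ q′ n ⟨
  coeff (p′ +P q′) n        ∎
  where open ≡-Reasoning

+P-identityʳ : ∀ p → p +P [] ≋ p
+P-identityʳ []      = ≋-refl
+P-identityʳ (a ∷ p) = ≋-refl

+P-assoc : ∀ p q r → (p +P q) +P r ≋ p +P (q +P r)
+P-assoc p q r = ≈P⇒≋ λ n → begin
  coeff ((p +P q) +P r) n                   ≡⟨ coeff-+P (p +P q) r n ⟩
  coeff (p +P q) n +ℤ coeff r n             ≡⟨ cong (_+ℤ coeff r n) (coeff-+P p q n) ⟩
  (coeff p n +ℤ coeff q n) +ℤ coeff r n     ≡⟨ ℤ.+-assoc (coeff p n) (coeff q n) (coeff r n) ⟩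
  coeff p n +ℤ (coeff q n +ℤ coeff r n)     ≡⟨ cong (coeff p n +ℤ_) (coeff-+P q r n) ⟨
  coeff p n +ℤ coeff (q +P r) n             ≡⟨ coeff-+P p (q +P r) n ⟨
  coeff (p +P (q +P r)) n                   ∎
  where open ≡-Reasoning

+P-comm : ∀ p q → p +P q ≋ q +P p
+P-comm p q = ≈P⇒≋ λ n → begin
  coeff (p +P q) n        ≡⟨ coeff-+P p q n ⟩
  coeff p n +ℤ coeff q n  ≡⟨ ℤ.+-comm (coeff p n) (coeff q n) ⟩
  coeff q n +ℤ coeff p n  ≡⟨ coeff-+P q p n ⟨
  coeff (q +P p) n        ∎
  where open ≡-Reasoning

+P-commutativeSemigroup : CommutativeSemigroup _ _
+P-commutativeSemigroup = record
  { isCommutativeSemigroup = record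
    { isSemigroup = record
      { isMagma = record { isEquivalence = Setoid.isEquivalence Poly-setoid ; ∙-cong = +P-cong }
      ; assoc = +P-assoc }
    ; comm = +P-comm } }

module +P = CommutativeSemigroupProperties +P-commutativeSemigroup

scale-cong : ∀ c {p q} → p ≋ q → scale c p ≋ scale c q
scale-cong c {p} {q} (≈P⇒≋ h) = ≈P⇒≋ λ n → begin
  coeff (scale c p) n  ≡⟨ coeff-scale c p n ⟩
  c *ℤ coeff p n       ≡⟨ cong (c *ℤ_) (h n) ⟩
  c *ℤ coeff q n       ≡⟨ coeff-scale c q n ⟨
  coeff (scale c q) n  ∎
  where open ≡-Reasoning

scale-zero : ∀ p → scale 0ℤ p ≋ []
scale-zero p = ≈P⇒≋ λ n → trans (coeff-scale 0ℤ p n) (ℤ.*-zeroˡ (coeff p n))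

scale-one : ∀ p → scale 1ℤ p ≋ p
scale-one p = ≈P⇒≋ λ n → trans (coeff-scale 1ℤ p n) (ℤ.*-identityˡ (coeff p n))

scale-distribˡ : ∀ c p q → scale c (p +P q) ≋ scale c p +P scale c q
scale-distribˡ c p q = ≈P⇒≋ λ n → begin
  coeff (scale c (p +P q)) n                    ≡⟨ coeff-scale c (p +P q) n ⟩
  c *ℤ coeff (p +P q) n                         ≡⟨ cong (c *ℤ_) (coeff-+P p q n) ⟩
  c *ℤ (coeff p n +ℤ coeff q n)                 ≡⟨ ℤ.*-distribˡ-+ c (coeff p n) (coeff q n) ⟩
  c *ℤ coeff p n +ℤ c *ℤ coeff q n              ≡⟨ cong₂ _+ℤ_ (coeff-scale c p n) (coeff-scale c q n) ⟨
  coeff (scale c p) n +ℤ coeff (scale c q) n    ≡⟨ coeff-+P (scale c p) (scale c q) n ⟨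
  coeff (scale c p +P scale c q) n              ∎
  where open ≡-Reasoning

scale-distribʳ : ∀ a b p → scale (a +ℤ b) p ≋ scale a p +P scale b p
scale-distribʳ a b p = ≈P⇒≋ λ n → begin
  coeff (scale (a +ℤ b) p) n                    ≡⟨ coeff-scale (a +ℤ b) p n ⟩
  (a +ℤ b) *ℤ coeff p n                         ≡⟨ ℤ.*-distribʳ-+ (coeff p n) a b ⟩
  a *ℤ coeff p n +ℤ b *ℤ coeff p n              ≡⟨ cong₂ _+ℤ_ (coeff-scale a p n) (coeff-scale b p n) ⟨
  coeff (scale a p) n +ℤ coeff (scale b p) n    ≡⟨ coeff-+P (scale a p) (scale b p) n ⟨
  coeff (scale a p +P scale b p) n              ∎
  where open ≡-Reasoning

scale-scale : ∀ a b p → scale a (scale b p) ≋ scale (a *ℤ b) p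
scale-scale a b p = ≈P⇒≋ λ n → begin
  coeff (scale a (scale b p)) n  ≡⟨ coeff-scale a (scale b p) n ⟩
  a *ℤ coeff (scale b p) n       ≡⟨ cong (a *ℤ_) (coeff-scale b p n) ⟩
  a *ℤ (b *ℤ coeff p n)          ≡⟨ ℤ.*-assoc a b (coeff p n) ⟨
  (a *ℤ b) *ℤ coeff p n          ≡⟨ coeff-scale (a *ℤ b) p n ⟨
  coeff (scale (a *ℤ b) p) n     ∎
  where open ≡-Reasoning

*P-congʳ : ∀ p {q q′} → q ≋ q′ → p *P q ≋ p *P q′
*P-congʳ []      q≋q′ = ≋-refl
*P-congʳ (a ∷ p) q≋q′ = +P-cong (scale-cong a q≋q′) (∷-cong refl (*P-congʳ p q≋q′))

*P-zeroʳ : ∀ p → p *P [] ≋ []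
*P-zeroʳ []      = ≋-refl
*P-zeroʳ (a ∷ p) = ≋-trans (∷-cong refl (*P-zeroʳ p)) 0∷[]≋[]

*P-∷ʳ : ∀ p a q → p *P (a ∷ q) ≋ scale a p +P (0ℤ ∷ p *P q)
*P-∷ʳ []      a q = ≋-sym 0∷[]≋[]
*P-∷ʳ (b ∷ p) a q =
  ∷-cong (cong (_+ℤ 0ℤ) (ℤ.*-comm b a))
         (≋-trans (+P-cong (≋-refl {scale b q}) (*P-∷ʳ p a q)) (+P.x∙yz≈y∙xz (scale b q) (scale a p) _))

*P-comm : ∀ p q → p *P q ≋ q *P p
*P-comm []      q = ≋-sym (*P-zeroʳ q)
*P-comm (a ∷ p) q =
  ≋-trans (+P-cong (≋-refl {scale a q}) (∷-cong refl (*P-comm p q))) (≋-sym (*P-∷ʳ q a p))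

*P-congˡ : ∀ {p p′} q → p ≋ p′ → p *P q ≋ p′ *P q
*P-congˡ {p} {p′} q p≋p′ = begin
  p *P q   ≈⟨ *P-comm p q ⟩
  q *P p   ≈⟨ *P-congʳ q p≋p′ ⟩
  q *P p′  ≈⟨ *P-comm q p′ ⟩
  p′ *P q  ∎
  where open ≋-Reasoning

*P-cong : ∀ {p p′ q q′} → p ≋ p′ → q ≋ q′ → p *P q ≋ p′ *P q′
*P-cong {p′ = p′} {q = q} p≋p′ q≋q′ = ≋-trans (*P-congˡ q p≋p′) (*P-congʳ p′ q≋q′)

*P-distribʳ : ∀ p q r → (p +P q) *P r ≋ p *P r +P q *P r
*P-distribʳ []      q       r = ≋-refl
*P-distribʳ (a ∷ p) []      r = ≋-sym (+P-identityʳ _)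
*P-distribʳ (a ∷ p) (b ∷ q) r =
  ≋-trans (+P-cong (scale-distribʳ a b r) (∷-cong refl (*P-distribʳ p q r)))
          (+P.interchange (scale a r) (scale b r) (0ℤ ∷ p *P r) (0ℤ ∷ q *P r))

scale-*P : ∀ c p q → scale c p *P q ≋ scale c (p *P q)
scale-*P c []      q = ≋-refl
scale-*P c (a ∷ p) q =
  ≋-trans (+P-cong (≋-sym (scale-scale c a q)) (∷-cong (sym (ℤ.*-zeroʳ c)) (scale-*P c p q)))
          (≋-sym (scale-distribˡ c (scale a q) (0ℤ ∷ p *P q)))

0∷-*P : ∀ p q → (0ℤ ∷ p) *P q ≋ 0ℤ ∷ p *P q
0∷-*P p q = +P-cong (scale-zero q) (≋-refl {0ℤ ∷ p *P q})

*P-assoc : ∀ p q r → (p *P q) *P r ≋ p *P (q *P r)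
*P-assoc []      q r = ≋-refl
*P-assoc (a ∷ p) q r = begin
  (scale a q +P (0ℤ ∷ p *P q)) *P r
    ≈⟨ *P-distribʳ (scale a q) _ r ⟩
  scale a q *P r +P (0ℤ ∷ p *P q) *P r
    ≈⟨ +P-cong (scale-*P a q r) (≋-trans (0∷-*P (p *P q) r) (∷-cong refl (*P-assoc p q r))) ⟩
  scale a (q *P r) +P (0ℤ ∷ p *P (q *P r)) ∎
  where open ≋-Reasoning

*P-identityˡ : ∀ p → oneP *P p ≋ p
*P-identityˡ p = ≋-trans (+P-cong (scale-one p) 0∷[]≋[]) (+P-identityʳ p)

*P-identityʳ : ∀ p → p *P oneP ≋ p
*P-identityʳ p = ≋-trans (*P-comm p oneP) (*P-identityˡ p)

*P-commutativeSemigroup : CommutativeSemigroup _ _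
*P-commutativeSemigroup = record
  { isCommutativeSemigroup = record
    { isSemigroup = record
      { isMagma = record { isEquivalence = Setoid.isEquivalence Poly-setoid ; ∙-cong = *P-cong }
      ; assoc = *P-assoc }
    ; comm = *P-comm } }

module *P = CommutativeSemigroupProperties *P-commutativeSemigroup

z-*P : ∀ p → z *P p ≋ 0ℤ ∷ p
z-*P p = +P-cong (scale-zero p) (∷-cong refl (*P-identityˡ p))

-- Substitution z ↦ z²

double : ℕ → ℕ
double zero    = zero
double (suc n) = suc (suc (double n))

data Parity : ℕ → Set where
  even : ∀ j → Parity (double j)
  odd  : ∀ j → Parity (suc (double j))

parity : ∀ n → Parity n
parity zero = even 0
parity (suc n) with parity n
... | even j = odd j
... | odd j  = even (suc j)

infixl 8 _∘z²

_∘z² : Poly → Poly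
[]      ∘z² = []
(a ∷ p) ∘z² = a ∷ 0ℤ ∷ p ∘z²

coeff-∘z²-even : ∀ p j → coeff (p ∘z²) (double j) ≡ coeff p j
coeff-∘z²-even []      j       = refl
coeff-∘z²-even (a ∷ p) zero    = refl
coeff-∘z²-even (a ∷ p) (suc j) = coeff-∘z²-even p j

coeff-∘z²-odd : ∀ p j → coeff (p ∘z²) (suc (double j)) ≡ 0ℤ
coeff-∘z²-odd []      j       = refl
coeff-∘z²-odd (a ∷ p) zero    = refl
coeff-∘z²-odd (a ∷ p) (suc j) = coeff-∘z²-odd p j

∘z²-cong : ∀ {p q} → p ≋ q → p ∘z² ≋ q ∘z²
∘z²-cong {p} {q} (≈P⇒≋ h) = ≈P⇒≋ λ n → go n (parity n)
  where
  go : ∀ n → Parity n → coeff (p ∘z²) n ≡ coeff (q ∘z²) n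
  go _ (even j) = trans (coeff-∘z²-even p j) (trans (h j) (sym (coeff-∘z²-even q j)))
  go _ (odd j)  = trans (coeff-∘z²-odd p j) (sym (coeff-∘z²-odd q j))

∘z²-+P : ∀ p q → (p +P q) ∘z² ≋ p ∘z² +P q ∘z²
∘z²-+P []      q       = ≋-refl
∘z²-+P (a ∷ p) []      = ≋-refl
∘z²-+P (a ∷ p) (b ∷ q) = ∷-cong refl (∷-cong refl (∘z²-+P p q))

∘z²-scale : ∀ c p → scale c p ∘z² ≋ scale c (p ∘z²)
∘z²-scale c []      = ≋-refl
∘z²-scale c (a ∷ p) = ∷-cong refl (∷-cong (sym (ℤ.*-zeroʳ c)) (∘z²-scale c p))

∘z²-*P : ∀ p q → (p *P q) ∘z² ≋ p ∘z² *P q ∘z²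
∘z²-*P []      q = ≋-refl
∘z²-*P (a ∷ p) q =
  ≋-trans (∘z²-+P (scale a q) (0ℤ ∷ p *P q))
          (+P-cong (∘z²-scale a q)
                   (∷-cong refl (≋-sym (≋-trans (0∷-*P (p ∘z²) (q ∘z²)) (∷-cong refl (≋-sym (∘z²-*P p q)))))))

∘z²-zPow : ∀ k → zPow k ∘z² ≋ zPow (2 * k)
∘z²-zPow zero    = ∷-cong refl 0∷[]≋[]
∘z²-zPow (suc k) =
  ≋-trans (∷-cong refl (∷-cong refl (∘z²-zPow k))) (≡⇒≋ (cong zPow (sym (*-suc 2 k))))

prodBelow-cong : ∀ k {f g} → (∀ n → n < k → f n ≋ g n) → prodBelow k f ≋ prodBelow k g
prodBelow-cong zero    f≋g = ≋-refl
prodBelow-cong (suc k) f≋g =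
  *P-cong (prodBelow-cong k (λ n n<k → f≋g n (m≤n⇒m≤1+n n<k))) (f≋g k ≤-refl)

prodBelow-*P : ∀ k f g → prodBelow k (λ n → f n *P g n) ≋ prodBelow k f *P prodBelow k g
prodBelow-*P zero    f g = ≋-sym (*P-identityˡ oneP)
prodBelow-*P (suc k) f g =
  ≋-trans (*P-congˡ (f k *P g k) (prodBelow-*P k f g))
          (*P.interchange (prodBelow k f) (prodBelow k g) (f k) (g k))

prodBelow-suc : ∀ k f → prodBelow (suc k) f ≋ f 0 *P prodBelow k (λ n → f (suc n))
prodBelow-suc zero    f = *P-comm oneP (f 0)
prodBelow-suc (suc k) f =
  ≋-trans (*P-congˡ (f (suc k)) (prodBelow-suc k f))
          (*P-assoc (f 0) (prodBelow k (λ n → f (suc n))) (f (suc k)))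

prodBelow-∘z² : ∀ k f → prodBelow k f ∘z² ≋ prodBelow k (λ n → f n ∘z²)
prodBelow-∘z² zero    f = ∘z²-zPow 0
prodBelow-∘z² (suc k) f =
  ≋-trans (∘z²-*P (prodBelow k f) (f k)) (*P-congˡ (f k ∘z²) (prodBelow-∘z² k f))

Φ Ψ : ℕ → Poly
Φ n = oneP +P zPow (2 ^ n) +P zPow (2 ^ suc n)
Ψ n = oneP -P zPow (2 ^ n) +P zPow (2 ^ suc n)

Φ-∘z² : ∀ n → Φ n ∘z² ≋ Φ (suc n)
Φ-∘z² n =
  ≋-trans (∘z²-+P (oneP +P zPow (2 ^ n)) (zPow (2 ^ suc n)))
  (+P-cong (≋-trans (∘z²-+P oneP (zPow (2 ^ n))) (+P-cong (∘z²-zPow 0) (∘z²-zPow (2 ^ n))))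
           (∘z²-zPow (2 ^ suc n)))

Ψ-∘z² : ∀ n → Ψ n ∘z² ≋ Ψ (suc n)
Ψ-∘z² n =
  ≋-trans (∘z²-+P (oneP -P zPow (2 ^ n)) (zPow (2 ^ suc n)))
  (+P-cong (≋-trans (∘z²-+P oneP (negP (zPow (2 ^ n))))
             (+P-cong (∘z²-zPow 0)
                      (≋-trans (∘z²-scale -1ℤ (zPow (2 ^ n))) (scale-cong -1ℤ (∘z²-zPow (2 ^ n))))))
           (∘z²-zPow (2 ^ suc n)))

Φ-suc : ∀ n → Φ (suc n) ≋ Φ n *P Ψ n
Φ-suc zero    = ≋-refl
Φ-suc (suc n) = begin
  Φ (suc (suc n))           ≈⟨ Φ-∘z² (suc n) ⟨
  Φ (suc n) ∘z²             ≈⟨ ∘z²-cong (Φ-suc n) ⟩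
  (Φ n *P Ψ n) ∘z²          ≈⟨ ∘z²-*P (Φ n) (Ψ n) ⟩
  Φ n ∘z² *P Ψ n ∘z²        ≈⟨ *P-cong (Φ-∘z² n) (Ψ-∘z² n) ⟩
  Φ (suc n) *P Ψ (suc n)    ∎
  where open ≋-Reasoning

Φ≋Φ₀*∏Ψ : ∀ n → Φ n ≋ Φ 0 *P prodBelow n Ψ
Φ≋Φ₀*∏Ψ zero    = ≋-sym (*P-identityʳ (Φ 0))
Φ≋Φ₀*∏Ψ (suc n) = begin
  Φ (suc n)                             ≈⟨ Φ-suc n ⟩
  Φ n *P Ψ n                            ≈⟨ *P-congˡ (Ψ n) (Φ≋Φ₀*∏Ψ n) ⟩
  (Φ 0 *P prodBelow n Ψ) *P Ψ n         ≈⟨ *P-assoc (Φ 0) (prodBelow n Ψ) (Ψ n) ⟩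
  Φ 0 *P prodBelow (suc n) Ψ            ∎
  where open ≋-Reasoning

Ψ-triangle : ℕ → Poly
Ψ-triangle k = prodBelow k (λ n → Ψ n ^P (k ∸ n))

Ψ-triangle-suc : ∀ k → Ψ-triangle (suc k) ≋ prodBelow (suc k) Ψ *P Ψ-triangle k
Ψ-triangle-suc k = begin
  Ψ-triangle (suc k)
    ≈⟨ prodBelow-cong (suc k) peel ⟩
  prodBelow (suc k) (λ n → Ψ n *P Ψ n ^P (k ∸ n))
    ≈⟨ prodBelow-*P (suc k) Ψ (λ n → Ψ n ^P (k ∸ n)) ⟩
  prodBelow (suc k) Ψ *P (Ψ-triangle k *P Ψ k ^P (k ∸ k))
    ≈⟨ *P-congʳ (prodBelow (suc k) Ψ) (≋-trans (*P-congʳ (Ψ-triangle k) (≡⇒≋ (cong (Ψ k ^P_) (n∸n≡0 k))))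
                                                (*P-identityʳ (Ψ-triangle k))) ⟩
  prodBelow (suc k) Ψ *P Ψ-triangle k ∎
  where
  open ≋-Reasoning
  peel : ∀ n → n < suc k → Ψ n ^P (suc k ∸ n) ≋ Ψ n *P Ψ n ^P (k ∸ n)
  peel n n<1+k = ≡⇒≋ (cong (Ψ n ^P_) (+-∸-assoc 1 (≤-pred n<1+k)))

Φ₀^*Ψ-triangle : ∀ e → Φ 0 ^P e *P Ψ-triangle (e ∸ 1) ≋ prodBelow e Φ
Φ₀^*Ψ-triangle zero          = *P-identityˡ oneP
Φ₀^*Ψ-triangle (suc zero)    =
  ≋-trans (*P-identityʳ _) (≋-trans (*P-identityʳ (Φ 0)) (≋-sym (*P-identityˡ (Φ 0))))
Φ₀^*Ψ-triangle (suc (suc k)) = begin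
  (Φ 0 *P Φ 0 ^P suc k) *P Ψ-triangle (suc k)
    ≈⟨ *P-congʳ (Φ 0 *P Φ 0 ^P suc k) (Ψ-triangle-suc k) ⟩
  (Φ 0 *P Φ 0 ^P suc k) *P (prodBelow (suc k) Ψ *P Ψ-triangle k)
    ≈⟨ *P.interchange (Φ 0) (Φ 0 ^P suc k) (prodBelow (suc k) Ψ) (Ψ-triangle k) ⟩
  (Φ 0 *P prodBelow (suc k) Ψ) *P (Φ 0 ^P suc k *P Ψ-triangle k)
    ≈⟨ *P-cong (≋-sym (Φ≋Φ₀*∏Ψ (suc k))) (Φ₀^*Ψ-triangle (suc k)) ⟩
  Φ (suc k) *P prodBelow (suc k) Φ
    ≈⟨ *P-comm (Φ (suc k)) (prodBelow (suc k) Φ) ⟩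
  prodBelow (suc (suc k)) Φ ∎
  where open ≋-Reasoning

Φ₀-*P : ∀ p → Φ 0 *P p ≋ p +P (0ℤ ∷ p +P (0ℤ ∷ p))
Φ₀-*P p = +P-cong (scale-one p) (∷-cong refl (+P-cong (scale-one p) (∷-cong refl (*P-identityˡ p))))

coeff-0∷∘z²-even : ∀ q j → coeff (0ℤ ∷ q ∘z²) (double j) ≡ 0ℤ
coeff-0∷∘z²-even q zero    = refl
coeff-0∷∘z²-even q (suc j) = coeff-∘z²-odd q j

z*P≋Φ₀*P∘z² : ∀ p q → coeff q 0 ≡ 0ℤ →
  (∀ j → coeff p (double j) ≡ coeff q j) →
  (∀ j → coeff p (suc (double j)) ≡ coeff q j +ℤ coeff q (suc j)) →
  z *P p ≋ Φ 0 *P q ∘z²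
z*P≋Φ₀*P∘z² p q q₀≡0 p-even p-odd =
  ≋-trans (z-*P p) (≋-trans (≈P⇒≋ coeffs) (≋-sym (Φ₀-*P (q ∘z²))))
  where
  X : Poly
  X = q ∘z²

  coeff-Φ₀X-suc : ∀ n → coeff (X +P (0ℤ ∷ X +P (0ℤ ∷ X))) (suc n)
                      ≡ coeff X (suc n) +ℤ (coeff X n +ℤ coeff (0ℤ ∷ X) n)
  coeff-Φ₀X-suc n = trans (coeff-+P X (0ℤ ∷ X +P (0ℤ ∷ X)) (suc n))
                          (cong (coeff X (suc n) +ℤ_) (coeff-+P X (0ℤ ∷ X) n))

  coeffs-suc : ∀ n → Parity n → coeff p n ≡ coeff (X +P (0ℤ ∷ X +P (0ℤ ∷ X))) (suc n)
  coeffs-suc _ (even j) = begin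
    coeff p (double j)                                          ≡⟨ p-even j ⟩
    coeff q j                                                   ≡⟨ ℤ.+-identityʳ (coeff q j) ⟨
    coeff q j +ℤ 0ℤ                                             ≡⟨ ℤ.+-identityˡ (coeff q j +ℤ 0ℤ) ⟨
    0ℤ +ℤ (coeff q j +ℤ 0ℤ)
      ≡⟨ cong₂ (λ a b → a +ℤ (b +ℤ 0ℤ)) (coeff-∘z²-odd q j) (coeff-∘z²-even q j) ⟨
    coeff X (suc (double j)) +ℤ (coeff X (double j) +ℤ 0ℤ)
      ≡⟨ cong (λ c → coeff X (suc (double j)) +ℤ (coeff X (double j) +ℤ c)) (coeff-0∷∘z²-even q j) ⟨
    coeff X (suc (double j)) +ℤ (coeff X (double j) +ℤ coeff (0ℤ ∷ X) (double j))
      ≡⟨ coeff-Φ₀X-suc (double j) ⟨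
    coeff (X +P (0ℤ ∷ X +P (0ℤ ∷ X))) (suc (double j))          ∎
    where open ≡-Reasoning
  coeffs-suc _ (odd j) = begin
    coeff p (suc (double j))                                    ≡⟨ p-odd j ⟩
    coeff q j +ℤ coeff q (suc j)                                ≡⟨ ℤ.+-comm (coeff q j) (coeff q (suc j)) ⟩
    coeff q (suc j) +ℤ coeff q j                                ≡⟨ cong (coeff q (suc j) +ℤ_) (ℤ.+-identityˡ (coeff q j)) ⟨
    coeff q (suc j) +ℤ (0ℤ +ℤ coeff q j)
      ≡⟨ cong₂ (λ a b → a +ℤ (b +ℤ coeff q j)) (coeff-∘z²-even q (suc j)) (coeff-∘z²-odd q j) ⟨
    coeff X (double (suc j)) +ℤ (coeff X (suc (double j)) +ℤ coeff q j)
      ≡⟨ cong (λ c → coeff X (double (suc j)) +ℤ (coeff X (suc (double j)) +ℤ c)) (coeff-∘z²-even q j) ⟨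
    coeff X (double (suc j)) +ℤ (coeff X (suc (double j)) +ℤ coeff X (double j))
      ≡⟨ coeff-Φ₀X-suc (suc (double j)) ⟨
    coeff (X +P (0ℤ ∷ X +P (0ℤ ∷ X))) (double (suc j))          ∎
    where open ≡-Reasoning

  coeffs : ∀ n → coeff (0ℤ ∷ p) n ≡ coeff (X +P (0ℤ ∷ X +P (0ℤ ∷ X))) n
  coeffs zero    = sym (trans (coeff-+P X _ 0) (trans (cong (_+ℤ 0ℤ) (coeff-∘z²-even q 0)) (cong (_+ℤ 0ℤ) q₀≡0)))
  coeffs (suc n) = coeffs-suc n (parity n)

-- The twisted Stern sequence

double-+ : ∀ m n → double (m + n) ≡ double m + double n
double-+ zero    n = refl
double-+ (suc m) n = cong (λ k → suc (suc k)) (double-+ m n)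

double≡+ : ∀ n → double n ≡ n + n
double≡+ zero    = refl
double≡+ (suc n) = cong suc (trans (cong suc (double≡+ n)) (sym (+-suc n n)))

double-mono-≤ : ∀ {m n} → m ≤ n → double m ≤ double n
double-mono-≤ z≤n       = z≤n
double-mono-≤ (s≤s m≤n) = s≤s (s≤s (double-mono-≤ m≤n))

n≤double : ∀ n → n ≤ double n
n≤double zero    = z≤n
n≤double (suc n) = s≤s (m≤n⇒m≤1+n (n≤double n))

isEven-double : ∀ k → isEven (double k) ≡ true
isEven-double zero    = refl
isEven-double (suc k) = isEven-double k

isEven-double+1 : ∀ k → isEven (suc (double k)) ≡ false
isEven-double+1 zero    = refl
isEven-double+1 (suc k) = isEven-double+1 k

⌊double/2⌋ : ∀ k → ⌊ double k /2⌋ ≡ k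
⌊double/2⌋ zero    = refl
⌊double/2⌋ (suc k) = cong suc (⌊double/2⌋ k)

⌊double+1/2⌋ : ∀ k → ⌊ suc (double k) /2⌋ ≡ k
⌊double+1/2⌋ zero    = refl
⌊double+1/2⌋ (suc k) = cong suc (⌊double+1/2⌋ k)

-- Every recursive call of tFuel is at a smaller argument.
tFuel-stable : ∀ {f g} n → n < f → n < g → tFuel f n ≡ tFuel g n
tFuel-stable {suc f} {suc g} zero                _         _         = refl
tFuel-stable {suc f} {suc g} (suc zero)          _         _         = refl
tFuel-stable {suc f} {suc g} (suc (suc zero))    (s≤s n<f) (s≤s n<g) = cong -_ (tFuel-stable 1 n<f n<g)
tFuel-stable {suc f} {suc g} (suc (suc (suc m))) (s≤s n<f) (s≤s n<g) =
  cong₂ (λ a b → if isEven (suc m) then - a else - a - b)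
        (tFuel-stable (suc h) (≤-trans (s≤s (s≤s h≤m)) (≤-trans (n≤1+n _) n<f))
                              (≤-trans (s≤s (s≤s h≤m)) (≤-trans (n≤1+n _) n<g)))
        (tFuel-stable (suc (suc h)) (≤-trans (s≤s (s≤s (s≤s h≤m))) n<f)
                                    (≤-trans (s≤s (s≤s (s≤s h≤m))) n<g))
  where
  h : ℕ
  h = ⌊ suc m /2⌋
  h≤m : h ≤ m
  h≤m = ≤-pred (⌊n/2⌋<n m)

tFuel≡t : ∀ {f} n → n < f → tFuel f n ≡ t n
tFuel≡t n n<f = tFuel-stable n n<f ≤-refl

t-double : ∀ m → 1 ≤ m → t (double m) ≡ - t m
t-double (suc k) _ rewrite isEven-double k | ⌊double/2⌋ k =
  cong -_ (tFuel≡t (suc k) (s≤s (s≤s (n≤double k))))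

t-double+1 : ∀ m → 1 ≤ m → t (suc (double m)) ≡ - t m - t (suc m)
t-double+1 (suc k) _ rewrite isEven-double+1 k | ⌊double+1/2⌋ k =
  cong₂ (λ a b → - a - b) (tFuel≡t (suc k) (s≤s (s≤s (m≤n⇒m≤1+n (n≤double k)))))
                          (tFuel≡t (suc (suc k)) (s≤s (s≤s (s≤s (n≤double k)))))

sternWindow : ℕ → Poly
sternWindow M = applyUpTo (λ n → t (M + n)) (suc M)

coeff-applyUpTo : ∀ f {m} n → n < m → coeff (applyUpTo f m) n ≡ f n
coeff-applyUpTo f zero    (s≤s _)   = refl
coeff-applyUpTo f (suc n) (s≤s n<m) = coeff-applyUpTo (λ k → f (suc k)) n n<m

coeff-applyUpTo-≥ : ∀ f {m} n → m ≤ n → coeff (applyUpTo f m) n ≡ 0ℤ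
coeff-applyUpTo-≥ f n       z≤n       = refl
coeff-applyUpTo-≥ f (suc n) (s≤s m≤n) = coeff-applyUpTo-≥ (λ k → f (suc k)) n m≤n

coeff-sternWindow : ∀ M n → n ≤ M → coeff (sternWindow M) n ≡ t (M + n)
coeff-sternWindow M n n≤M = coeff-applyUpTo (λ k → t (M + k)) n (s≤s n≤M)

coeff-sternWindow-> : ∀ M n → M < n → coeff (sternWindow M) n ≡ 0ℤ
coeff-sternWindow-> M n = coeff-applyUpTo-≥ (λ k → t (M + k)) n

coeff-sternWindow-≥ : ∀ M n → t (M + M) ≡ 0ℤ → M ≤ n → coeff (sternWindow M) n ≡ 0ℤ
coeff-sternWindow-≥ M n t2M≡0 M≤n with m≤n⇒m<n∨m≡n M≤n
... | inj₁ M<n  = coeff-sternWindow-> M n M<n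
... | inj₂ refl = trans (coeff-sternWindow M M ≤-refl) t2M≡0

coeff-sternWindow-double-even : ∀ M j → 1 ≤ M →
  coeff (sternWindow (double M)) (double j) ≡ - coeff (sternWindow M) j
coeff-sternWindow-double-even M j 1≤M with ≤-<-connex j M
... | inj₁ j≤M = begin
  coeff (sternWindow (double M)) (double j)  ≡⟨ coeff-sternWindow (double M) (double j) (double-mono-≤ j≤M) ⟩
  t (double M + double j)                    ≡⟨ cong t (double-+ M j) ⟨
  t (double (M + j))                         ≡⟨ t-double (M + j) (≤-trans 1≤M (m≤m+n M j)) ⟩
  - t (M + j)                                ≡⟨ cong -_ (coeff-sternWindow M j j≤M) ⟨
  - coeff (sternWindow M) j                  ∎
  where open ≡-Reasoning
... | inj₂ M<j = trans (coeff-sternWindow-> (double M) (double j) (≤-trans (n≤1+n _) (double-mono-≤ M<j)))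
                       (cong -_ (sym (coeff-sternWindow-> M j M<j)))

coeff-sternWindow-double-odd : ∀ M j → 1 ≤ M → t (M + M) ≡ 0ℤ →
  coeff (sternWindow (double M)) (suc (double j)) ≡ - coeff (sternWindow M) j - coeff (sternWindow M) (suc j)
coeff-sternWindow-double-odd M j 1≤M t2M≡0 with <-≤-connex j M
... | inj₁ j<M = begin
  coeff (sternWindow (double M)) (suc (double j))
    ≡⟨ coeff-sternWindow (double M) (suc (double j)) (≤-trans (n≤1+n _) (double-mono-≤ j<M)) ⟩
  t (double M + suc (double j))
    ≡⟨ cong t (trans (+-suc (double M) (double j)) (cong suc (sym (double-+ M j)))) ⟩
  t (suc (double (M + j)))
    ≡⟨ t-double+1 (M + j) (≤-trans 1≤M (m≤m+n M j)) ⟩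
  - t (M + j) - t (suc (M + j))
    ≡⟨ cong₂ (λ a b → - a - t b) (sym (coeff-sternWindow M j (≤-trans (n≤1+n j) j<M))) (sym (+-suc M j)) ⟩
  - coeff (sternWindow M) j - t (M + suc j)
    ≡⟨ cong (λ b → - coeff (sternWindow M) j - b) (coeff-sternWindow M (suc j) j<M) ⟨
  - coeff (sternWindow M) j - coeff (sternWindow M) (suc j) ∎
  where open ≡-Reasoning
... | inj₂ M≤j = trans (coeff-sternWindow-> (double M) (suc (double j)) (s≤s (double-mono-≤ M≤j)))
  (sym (cong₂ (λ a b → - a - b) (coeff-sternWindow-≥ M j t2M≡0 M≤j)
                                (coeff-sternWindow-> M (suc j) (s≤s M≤j))))

start : ℕ → ℕ
start e = 3 * 2 ^ e

start-suc : ∀ e → start (suc e) ≡ double (start e)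
start-suc e = trans (3*2x≡3x+3x (2 ^ e)) (sym (double≡+ (start e)))
  where
  3*2x≡3x+3x : ∀ x → 3 * (2 * x) ≡ 3 * x + 3 * x
  3*2x≡3x+3x = ℕ-Solver.solve-∀

start-pos : ∀ e → 1 ≤ start e
start-pos zero    = s≤s z≤n
start-pos (suc e) = subst (1 ≤_) (sym (start-suc e)) (≤-trans (start-pos e) (n≤double (start e)))

t-start : ∀ e → t (start e) ≡ 0ℤ
t-start zero    = refl
t-start (suc e) = begin
  t (start (suc e))     ≡⟨ cong t (start-suc e) ⟩
  t (double (start e))  ≡⟨ t-double (start e) (start-pos e) ⟩
  - t (start e)         ≡⟨ cong -_ (t-start e) ⟩
  0ℤ                    ∎
  where open ≡-Reasoning

module _ (e : ℕ) where
  private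
    M : ℕ
    M = start e
    s : ℤ
    s = -1ℤ ^ℤ e
    W : Poly
    W = sternWindow M

    coeff-psi-suc : ∀ n → coeff (psi (suc e)) n ≡ (-1ℤ *ℤ s) *ℤ coeff (sternWindow (double M)) n
    coeff-psi-suc n = trans (coeff-scale (-1ℤ *ℤ s) (sternWindow (start (suc e))) n)
                            (cong (λ m → (-1ℤ *ℤ s) *ℤ coeff (sternWindow m) n) (start-suc e))

  coeff-psi-zero : coeff (psi e) 0 ≡ 0ℤ
  coeff-psi-zero = begin
    coeff (psi e) 0   ≡⟨ coeff-scale s W 0 ⟩
    s *ℤ coeff W 0    ≡⟨ cong (s *ℤ_) (coeff-sternWindow M 0 z≤n) ⟩
    s *ℤ t (M + 0)    ≡⟨ cong (λ m → s *ℤ t m) (+-identityʳ M) ⟩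
    s *ℤ t M          ≡⟨ cong (s *ℤ_) (t-start e) ⟩
    s *ℤ 0ℤ           ≡⟨ ℤ.*-zeroʳ s ⟩
    0ℤ                ∎
    where open ≡-Reasoning

  coeff-psi-suc-even : ∀ j → coeff (psi (suc e)) (double j) ≡ coeff (psi e) j
  coeff-psi-suc-even j = begin
    coeff (psi (suc e)) (double j)                    ≡⟨ coeff-psi-suc (double j) ⟩
    (-1ℤ *ℤ s) *ℤ coeff (sternWindow (double M)) (double j)
      ≡⟨ cong ((-1ℤ *ℤ s) *ℤ_) (coeff-sternWindow-double-even M j (start-pos e)) ⟩
    (-1ℤ *ℤ s) *ℤ (- coeff W j)                       ≡⟨ sign s (coeff W j) ⟩
    s *ℤ coeff W j                                    ≡⟨ coeff-scale s W j ⟨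
    coeff (psi e) j                                   ∎
    where
    open ≡-Reasoning
    sign : ∀ s a → (-1ℤ *ℤ s) *ℤ (- a) ≡ s *ℤ a
    sign = ℤ-Solver.solve-∀

  coeff-psi-suc-odd : ∀ j → coeff (psi (suc e)) (suc (double j)) ≡ coeff (psi e) j +ℤ coeff (psi e) (suc j)
  coeff-psi-suc-odd j = begin
    coeff (psi (suc e)) (suc (double j))              ≡⟨ coeff-psi-suc (suc (double j)) ⟩
    (-1ℤ *ℤ s) *ℤ coeff (sternWindow (double M)) (suc (double j))
      ≡⟨ cong ((-1ℤ *ℤ s) *ℤ_) (coeff-sternWindow-double-odd M j (start-pos e) t2M≡0) ⟩
    (-1ℤ *ℤ s) *ℤ (- coeff W j - coeff W (suc j))     ≡⟨ sign s (coeff W j) (coeff W (suc j)) ⟩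
    s *ℤ coeff W j +ℤ s *ℤ coeff W (suc j)            ≡⟨ cong₂ _+ℤ_ (coeff-scale s W j) (coeff-scale s W (suc j)) ⟨
    coeff (psi e) j +ℤ coeff (psi e) (suc j)          ∎
    where
    open ≡-Reasoning
    t2M≡0 : t (M + M) ≡ 0ℤ
    t2M≡0 = trans (cong t (trans (sym (double≡+ M)) (sym (start-suc e)))) (t-start (suc e))
    sign : ∀ s a b → (-1ℤ *ℤ s) *ℤ (- a - b) ≡ s *ℤ a +ℤ s *ℤ b
    sign = ℤ-Solver.solve-∀

psi-recursion : ∀ e → z *P psi (suc e) ≋ Φ 0 *P psi e ∘z²
psi-recursion e =
  z*P≋Φ₀*P∘z² (psi (suc e)) (psi e) (coeff-psi-zero e) (coeff-psi-suc-even e) (coeff-psi-suc-odd e)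

A : ℕ → Poly
A e = oneP +P zPow (2 ^ e)

A-∘z² : ∀ e → A e ∘z² ≋ A (suc e)
A-∘z² e = ≋-trans (∘z²-+P oneP (zPow (2 ^ e))) (+P-cong (∘z²-zPow 0) (∘z²-zPow (2 ^ e)))

Φ₀*∏Φ∘z² : ∀ e → Φ 0 *P prodBelow e Φ ∘z² ≋ prodBelow (suc e) Φ
Φ₀*∏Φ∘z² e = begin
  Φ 0 *P prodBelow e Φ ∘z²                        ≈⟨ *P-congʳ (Φ 0) (prodBelow-∘z² e Φ) ⟩
  Φ 0 *P prodBelow e (λ n → Φ n ∘z²)              ≈⟨ *P-congʳ (Φ 0) (prodBelow-cong e (λ n _ → Φ-∘z² n)) ⟩
  Φ 0 *P prodBelow e (λ n → Φ (suc n))            ≈⟨ prodBelow-suc e Φ ⟨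
  prodBelow (suc e) Φ                             ∎
  where open ≋-Reasoning

z*P-cancelˡ : ∀ {p q} → z *P p ≋ z *P q → p ≋ q
z*P-cancelˡ {p} {q} zp≋zq =
  ≈P⇒≋ λ n → ≋⇒≈P (≋-trans (≋-sym (z-*P p)) (≋-trans zp≋zq (z-*P q))) (suc n)

psi≋z*A*∏Φ : ∀ e → psi e ≋ z *P (A e *P prodBelow e Φ)
psi≋z*A*∏Φ zero    = ≈P⇒≋ λ { 0 → refl ; 1 → refl ; 2 → refl ; 3 → refl ; (suc (suc (suc (suc n)))) → refl }
psi≋z*A*∏Φ (suc e) = z*P-cancelˡ (begin
  z *P psi (suc e)
    ≈⟨ psi-recursion e ⟩
  Φ 0 *P psi e ∘z²
    ≈⟨ *P-congʳ (Φ 0) (∘z²-cong (psi≋z*A*∏Φ e)) ⟩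
  Φ 0 *P (z *P (A e *P P)) ∘z²
    ≈⟨ *P-congʳ (Φ 0) (≋-trans (∘z²-*P z (A e *P P)) (*P-congʳ (z ∘z²) (∘z²-*P (A e) P))) ⟩
  Φ 0 *P (z ∘z² *P (A e ∘z² *P P ∘z²))
    ≈⟨ *P-congʳ (Φ 0) (*P-cong (≋-trans (∘z²-zPow 1) (≋-sym (z-*P z))) (*P-congˡ (P ∘z²) (A-∘z² e))) ⟩
  Φ 0 *P ((z *P z) *P (A (suc e) *P P ∘z²))
    ≈⟨ *P.x∙yz≈y∙xz (Φ 0) (z *P z) _ ⟩
  (z *P z) *P (Φ 0 *P (A (suc e) *P P ∘z²))
    ≈⟨ *P-assoc z z _ ⟩
  z *P (z *P (Φ 0 *P (A (suc e) *P P ∘z²)))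
    ≈⟨ *P-congʳ z (*P-congʳ z (*P.x∙yz≈y∙xz (Φ 0) (A (suc e)) (P ∘z²))) ⟩
  z *P (z *P (A (suc e) *P (Φ 0 *P P ∘z²)))
    ≈⟨ *P-congʳ z (*P-congʳ z (*P-congʳ (A (suc e)) (Φ₀*∏Φ∘z² e))) ⟩
  z *P (z *P (A (suc e) *P prodBelow (suc e) Φ)) ∎)
  where
  open ≋-Reasoning
  P : Poly
  P = prodBelow e Φ

mainTheorem3 : (e : ℕ) →
    (psi e ≈P z *P (oneP +P zPow (2 ^ e)) *P ((oneP +P z +P zPow 2) ^P e)
                *P prodBelow (e ∸ 1) (λ n → (oneP -P zPow (2 ^ n) +P zPow (2 ^ suc n)) ^P (e ∸ 1 ∸ n)))
    × (psi e ≈P z *P (oneP +P zPow (2 ^ e))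
                *P prodBelow e (λ n → oneP +P zPow (2 ^ n) +P zPow (2 ^ suc n)))
mainTheorem3 e = ≋⇒≈P (≋-trans product-form (≋-sym triangle-form)) , ≋⇒≈P product-form
  where
  product-form : psi e ≋ z *P A e *P prodBelow e Φ
  product-form = ≋-trans (psi≋z*A*∏Φ e) (≋-sym (*P-assoc z (A e) (prodBelow e Φ)))
  triangle-form : z *P A e *P Φ 0 ^P e *P Ψ-triangle (e ∸ 1) ≋ z *P A e *P prodBelow e Φ
  triangle-form = ≋-trans (*P-assoc (z *P A e) (Φ 0 ^P e) (Ψ-triangle (e ∸ 1)))
                          (*P-congʳ (z *P A e) (Φ₀^*Ψ-triangle e))
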